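{- Let $n,k,d$ be positive integers. Suppose that there is a quaternary Hermitian LCD $[n,k,d]$ code $C$. If $d_4(n-1,k) \le d-1$, then $d(C^{\perp_H}) \ge 2$.
   Context: $\mathbb{F}_4=\{0,1,\omega,\omega^2\}$ is the field of order 4 with $\omega^2=\omega+1$, and $\overline{x}=x^2$ for $x\in\mathbb{F}_4$. A quaternary $[n,k]$ code is a $k$-dimensional subspace of $\mathbb{F}_4^n$; an $[n,k,d]$ code is one whose minimum nonzero Hamming weight $d(C)$ equals $d$. The Hermitian dual is $C^{\perp_H}=\{x\in\mathbb{F}_4^n : \sum_i x_i\overline{y_i}=0 \text{ for all } y\in C\}$. $C$ is Hermitian linear complementary dual (LCD) if $C\cap C^{\perp_H}=\{0\}$. $d_4(n,k)$ denotes the largest minimum weight among all quaternary Hermitian LCD $[n,k]$ codes. -}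

module Defs where

open import Data.Nat using (ℕ; zero; suc; _≤_)
open import Data.Fin using (Fin)
import Data.Fin as Fin
open import Data.Vec using (Vec; []; _∷_; replicate; zipWith; foldr)
open import Data.Product using (Σ; ∃; _×_; _,_)
open import Relation.Binary.PropositionalEquality using (_≡_; _≢_)
open import Level using (Level)

data F4 : Set where
  𝟎 𝟏 ω ω² : F4

infixl 6 _⊕_
infixl 7 _⊗_

_⊕_ : F4 → F4 → F4
𝟎  ⊕ y  = y
x  ⊕ 𝟎  = x
𝟏  ⊕ 𝟏  = 𝟎
𝟏  ⊕ ω  = ω²
𝟏  ⊕ ω² = ω
ω  ⊕ 𝟏  = ω²
ω  ⊕ ω  = 𝟎
ω  ⊕ ω² = 𝟏
ω² ⊕ 𝟏  = ω
ω² ⊕ ω  = 𝟏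
ω² ⊕ ω² = 𝟎

_⊗_ : F4 → F4 → F4
𝟎  ⊗ y  = 𝟎
x  ⊗ 𝟎  = 𝟎
𝟏  ⊗ y  = y
x  ⊗ 𝟏  = x
ω  ⊗ ω  = ω²
ω  ⊗ ω² = 𝟏
ω² ⊗ ω  = 𝟏
ω² ⊗ ω² = ω

conj : F4 → F4
conj x = x ⊗ x

Word : ℕ → Set
Word n = Vec F4 n

0w : (n : ℕ) → Word n
0w n = replicate n 𝟎

_+w_ : {n : ℕ} → Word n → Word n → Word n
_+w_ = zipWith _⊕_

_·w_ : {n : ℕ} → F4 → Word n → Word n
a ·w v = Data.Vec.map (a ⊗_) v

lincomb : {n : ℕ} (k : ℕ) → (Fin k → F4) → (Fin k → Word n) → Word n
lincomb {n} zero    c b = 0w n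
lincomb (suc k) c b = (c Fin.zero ·w b Fin.zero) +w lincomb k (λ i → c (Fin.suc i)) (λ i → b (Fin.suc i))

⟨_,_⟩H : {n : ℕ} → Word n → Word n → F4
⟨ x , y ⟩H = foldr _ _⊕_ 𝟎 (zipWith (λ a b → a ⊗ conj b) x y)

wt : {n : ℕ} → Word n → ℕ
wt [] = 0
wt (𝟎 ∷ v) = wt v
wt (_ ∷ v) = suc (wt v)

Code : ℕ → Set₁
Code n = Word n → Set

IsSubspaceOfDim : {n : ℕ} → ℕ → Code n → Set
IsSubspaceOfDim {n} k C =
  Σ (Fin k → Word n) λ b →
    (∀ x → C x → ∃ λ c → x ≡ lincomb k c b)
  × (∀ c → C (lincomb k c b))
  × (∀ c → lincomb k c b ≡ 0w n → ∀ i → c i ≡ 𝟎)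

HDual : {n : ℕ} → Code n → Code n
HDual C x = ∀ y → C y → ⟨ x , y ⟩H ≡ 𝟎

IsHermLCD : {n : ℕ} → Code n → Set
IsHermLCD {n} C = ∀ x → C x → HDual C x → x ≡ 0w n

HasMinWt : {n : ℕ} → Code n → ℕ → Set
HasMinWt {n} C d =
    (∃ λ x → C x × x ≢ 0w n × wt x ≡ d)
  × (∀ x → C x → x ≢ 0w n → d ≤ wt x)

IsHermLCDCode : (n k d : ℕ) → Code n → Set
IsHermLCDCode n k d C = IsSubspaceOfDim k C × IsHermLCD C × HasMinWt C d

IsD4 : (n k m : ℕ) → Set₁
IsD4 n k m =
    (Σ (Code n) λ C → IsHermLCDCode n k m C)
  × (∀ (C : Code n) d' → IsHermLCDCode n k d' C → d' ≤ m)

-- A nonzero word of weight 1 in the Hermitian dual of C is a nonzero multiple a·e_i, and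
-- a·conj(y_i) = 0 forces y_i = 0 for every y ∈ C. Deleting the coordinate i is then a
-- bijection of C onto a code of length n - 1 preserving dimension, the Hermitian form and
-- weights, so it is a Hermitian LCD [n-1,k,d] code and d ≤ d₄(n-1,k) ≤ d - 1, which is absurd.
module Submission where

open import Defs
open import Data.Nat using (ℕ; zero; suc; _≤_; _∸_; s≤s; z≤n)
open import Data.Nat.Properties using (≤-trans; suc-injective; n≮n)
open import Data.Product using (Σ; ∃; _×_; _,_)
open import Data.Fin using (Fin)
import Data.Fin as Fin
open import Data.Vec using ([]; _∷_; insertAt; removeAt; lookup)
open import Data.Vec.Properties using (removeAt-insertAt; insertAt-removeAt)
open import Data.Empty using (⊥-elim)
open import Function using (_∘_)
open import Relation.Binary.PropositionalEquality
  using (_≡_; _≢_; refl; sym; trans; cong; cong₂; subst; module ≡-Reasoning)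

⊕-identityʳ : (a : F4) → a ⊕ 𝟎 ≡ a
⊕-identityʳ 𝟎  = refl
⊕-identityʳ 𝟏  = refl
⊕-identityʳ ω  = refl
⊕-identityʳ ω² = refl

a⊗conj[b]≡𝟎⇒b≡𝟎 : (a b : F4) → a ≢ 𝟎 → a ⊗ conj b ≡ 𝟎 → b ≡ 𝟎
a⊗conj[b]≡𝟎⇒b≡𝟎 𝟎  b  a≢𝟎 _  = ⊥-elim (a≢𝟎 refl)
a⊗conj[b]≡𝟎⇒b≡𝟎 𝟏  𝟎  _   _  = refl
a⊗conj[b]≡𝟎⇒b≡𝟎 ω  𝟎  _   _  = refl
a⊗conj[b]≡𝟎⇒b≡𝟎 ω² 𝟎  _   _  = refl
a⊗conj[b]≡𝟎⇒b≡𝟎 𝟏  𝟏  _   ()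
a⊗conj[b]≡𝟎⇒b≡𝟎 𝟏  ω  _   ()
a⊗conj[b]≡𝟎⇒b≡𝟎 𝟏  ω² _   ()
a⊗conj[b]≡𝟎⇒b≡𝟎 ω  𝟏  _   ()
a⊗conj[b]≡𝟎⇒b≡𝟎 ω  ω  _   ()
a⊗conj[b]≡𝟎⇒b≡𝟎 ω  ω² _   ()
a⊗conj[b]≡𝟎⇒b≡𝟎 ω² 𝟏  _   ()
a⊗conj[b]≡𝟎⇒b≡𝟎 ω² ω  _   ()
a⊗conj[b]≡𝟎⇒b≡𝟎 ω² ω² _   ()

wt≡0⇒≡0w : {n : ℕ} (x : Word n) → wt x ≡ 0 → x ≡ 0w n
wt≡0⇒≡0w []       _ = refl
wt≡0⇒≡0w (𝟎 ∷ x) e = cong (𝟎 ∷_) (wt≡0⇒≡0w x e)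
wt≡0⇒≡0w (𝟏 ∷ x) ()
wt≡0⇒≡0w (ω ∷ x) ()
wt≡0⇒≡0w (ω² ∷ x) ()

wt≡1⇒multiple-of-unit : {n : ℕ} (x : Word (suc n)) → wt x ≡ 1 →
  Σ (Fin (suc n)) λ i → Σ F4 λ a → a ≢ 𝟎 × x ≡ insertAt (0w n) i a
wt≡1⇒multiple-of-unit {zero}  (𝟎 ∷ []) ()
wt≡1⇒multiple-of-unit {suc n} (𝟎 ∷ x) e with wt≡1⇒multiple-of-unit x e
... | i , a , a≢𝟎 , x≡ = Fin.suc i , a , a≢𝟎 , cong (𝟎 ∷_) x≡
wt≡1⇒multiple-of-unit (𝟏 ∷ x)  e = Fin.zero , 𝟏 , (λ ()) , cong (𝟏 ∷_) (wt≡0⇒≡0w x (suc-injective e))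
wt≡1⇒multiple-of-unit (ω ∷ x)  e = Fin.zero , ω , (λ ()) , cong (ω ∷_) (wt≡0⇒≡0w x (suc-injective e))
wt≡1⇒multiple-of-unit (ω² ∷ x) e = Fin.zero , ω² , (λ ()) , cong (ω² ∷_) (wt≡0⇒≡0w x (suc-injective e))

⟨0w,-⟩H : {n : ℕ} (y : Word n) → ⟨ 0w n , y ⟩H ≡ 𝟎
⟨0w,-⟩H []      = refl
⟨0w,-⟩H (_ ∷ y) = ⟨0w,-⟩H y

⟨unit,-⟩H : {n : ℕ} (i : Fin (suc n)) (a : F4) (y : Word (suc n)) →
  ⟨ insertAt (0w n) i a , y ⟩H ≡ a ⊗ conj (lookup y i)
⟨unit,-⟩H Fin.zero a (y ∷ ys) = trans (cong (a ⊗ conj y ⊕_) (⟨0w,-⟩H ys)) (⊕-identityʳ _)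
⟨unit,-⟩H {suc n} (Fin.suc i) a (_ ∷ ys) = ⟨unit,-⟩H i a ys

⟨insertAt𝟎,insertAt𝟎⟩H : {n : ℕ} (y z : Word n) (i : Fin (suc n)) →
  ⟨ insertAt y i 𝟎 , insertAt z i 𝟎 ⟩H ≡ ⟨ y , z ⟩H
⟨insertAt𝟎,insertAt𝟎⟩H y       z       Fin.zero    = refl
⟨insertAt𝟎,insertAt𝟎⟩H (a ∷ y) (b ∷ z) (Fin.suc i) =
  cong (a ⊗ conj b ⊕_) (⟨insertAt𝟎,insertAt𝟎⟩H y z i)

wt-insertAt𝟎 : {n : ℕ} (y : Word n) (i : Fin (suc n)) → wt (insertAt y i 𝟎) ≡ wt y
wt-insertAt𝟎 y        Fin.zero    = refl
wt-insertAt𝟎 (𝟎 ∷ y)  (Fin.suc i) = wt-insertAt𝟎 y i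
wt-insertAt𝟎 (𝟏 ∷ y)  (Fin.suc i) = cong suc (wt-insertAt𝟎 y i)
wt-insertAt𝟎 (ω ∷ y)  (Fin.suc i) = cong suc (wt-insertAt𝟎 y i)
wt-insertAt𝟎 (ω² ∷ y) (Fin.suc i) = cong suc (wt-insertAt𝟎 y i)

insertAt𝟎-0w : {n : ℕ} (i : Fin (suc n)) → insertAt (0w n) i 𝟎 ≡ 0w (suc n)
insertAt𝟎-0w         Fin.zero    = refl
insertAt𝟎-0w {suc n} (Fin.suc i) = cong (𝟎 ∷_) (insertAt𝟎-0w i)

removeAt-+w : {n : ℕ} (u v : Word (suc n)) (i : Fin (suc n)) →
  removeAt (u +w v) i ≡ removeAt u i +w removeAt v i
removeAt-+w (_ ∷ _)         (_ ∷ _)         Fin.zero    = refl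
removeAt-+w (_ ∷ u@(_ ∷ _)) (_ ∷ v@(_ ∷ _)) (Fin.suc i) = cong (_ ∷_) (removeAt-+w u v i)

removeAt-·w : {n : ℕ} (a : F4) (v : Word (suc n)) (i : Fin (suc n)) →
  removeAt (a ·w v) i ≡ a ·w removeAt v i
removeAt-·w a (_ ∷ _)         Fin.zero    = refl
removeAt-·w a (_ ∷ v@(_ ∷ _)) (Fin.suc i) = cong (_ ∷_) (removeAt-·w a v i)

removeAt-0w : {n : ℕ} (i : Fin (suc n)) → removeAt (0w (suc n)) i ≡ 0w n
removeAt-0w         Fin.zero    = refl
removeAt-0w {suc n} (Fin.suc i) = cong (𝟎 ∷_) (removeAt-0w i)

lincomb-linear : {m n : ℕ} (g : Word m → Word n) →
  (∀ u v → g (u +w v) ≡ g u +w g v) → (∀ a v → g (a ·w v) ≡ a ·w g v) →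
  g (0w m) ≡ 0w n →
  ∀ k c b → g (lincomb k c b) ≡ lincomb k c (g ∘ b)
lincomb-linear g g-+ g-· g-0 zero    c b = g-0
lincomb-linear g g-+ g-· g-0 (suc k) c b = begin
  g ((c₀ ·w b Fin.zero) +w lincomb k c′ b′)       ≡⟨ g-+ _ _ ⟩
  g (c₀ ·w b Fin.zero) +w g (lincomb k c′ b′)     ≡⟨ cong₂ _+w_ (g-· c₀ _)
                                                         (lincomb-linear g g-+ g-· g-0 k c′ b′) ⟩
  (c₀ ·w g (b Fin.zero)) +w lincomb k c′ (g ∘ b′) ∎
  where
  open ≡-Reasoning
  c₀ = c Fin.zero
  c′ = c ∘ Fin.suc
  b′ = b ∘ Fin.suc

HDual-wt≡1⇒vanishing-coordinate : {n : ℕ} (C : Code (suc n)) (x : Word (suc n)) →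
  HDual C x → wt x ≡ 1 → ∃ λ i → ∀ y → C y → lookup y i ≡ 𝟎
HDual-wt≡1⇒vanishing-coordinate C x x⊥C wt≡1 with wt≡1⇒multiple-of-unit x wt≡1
... | i , a , a≢𝟎 , refl =
  i , λ y y∈C →
    a⊗conj[b]≡𝟎⇒b≡𝟎 a (lookup y i) a≢𝟎 (trans (sym (⟨unit,-⟩H i a y)) (x⊥C y y∈C))

-- This is the code punctured at i only when every codeword of C vanishes at i.
puncture : {n : ℕ} → Code (suc n) → Fin (suc n) → Code n
puncture C i y = C (insertAt y i 𝟎)

module Puncture {n : ℕ} (C : Code (suc n)) (i : Fin (suc n))
                (vanish : ∀ y → C y → lookup y i ≡ 𝟎) where

  insertAt-removeAt-∈C : ∀ x → C x → insertAt (removeAt x i) i 𝟎 ≡ x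
  insertAt-removeAt-∈C x x∈C =
    subst (λ a → insertAt (removeAt x i) i a ≡ x) (vanish x x∈C) (insertAt-removeAt x i)

  removeAt-∈puncture : ∀ x → C x → puncture C i (removeAt x i)
  removeAt-∈puncture x x∈C = subst C (sym (insertAt-removeAt-∈C x x∈C)) x∈C

  insertAt𝟎≡0w⇒≡0w : ∀ y → insertAt y i 𝟎 ≡ 0w (suc n) → y ≡ 0w n
  insertAt𝟎≡0w⇒≡0w y e = begin
    y                           ≡⟨ removeAt-insertAt y i 𝟎 ⟨
    removeAt (insertAt y i 𝟎) i ≡⟨ cong (λ v → removeAt v i) e ⟩
    removeAt (0w (suc n)) i     ≡⟨ removeAt-0w i ⟩
    0w n                        ∎
    where open ≡-Reasoning

  removeAt-lincomb : ∀ k c b → removeAt (lincomb k c b) i ≡ lincomb k c (λ j → removeAt (b j) i)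
  removeAt-lincomb = lincomb-linear (λ v → removeAt v i)
    (λ u v → removeAt-+w u v i) (λ a v → removeAt-·w a v i) (removeAt-0w i)

  isSubspaceOfDim : ∀ {k} → IsSubspaceOfDim k C → IsSubspaceOfDim k (puncture C i)
  isSubspaceOfDim {k} (b , spans , lincomb∈C , independent) =
    b′ , spans′ , lincomb∈C′ , independent′
    where
    b′ : Fin k → Word n
    b′ j = removeAt (b j) i
    lincomb-b′ : ∀ c → insertAt (lincomb k c b′) i 𝟎 ≡ lincomb k c b
    lincomb-b′ c = trans (cong (λ v → insertAt v i 𝟎) (sym (removeAt-lincomb k c b)))
                         (insertAt-removeAt-∈C _ (lincomb∈C c))
    spans′ : ∀ y → puncture C i y → ∃ λ c → y ≡ lincomb k c b′
    spans′ y y∈C′ with spans _ y∈C′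
    ... | c , e = c , trans (sym (removeAt-insertAt y i 𝟎))
                            (trans (cong (λ v → removeAt v i) e) (removeAt-lincomb k c b))
    lincomb∈C′ : ∀ c → puncture C i (lincomb k c b′)
    lincomb∈C′ c = subst C (sym (lincomb-b′ c)) (lincomb∈C c)
    independent′ : ∀ c → lincomb k c b′ ≡ 0w n → ∀ j → c j ≡ 𝟎
    independent′ c e = independent c
      (trans (sym (lincomb-b′ c)) (trans (cong (λ v → insertAt v i 𝟎) e) (insertAt𝟎-0w i)))

  isHermLCD : IsHermLCD C → IsHermLCD (puncture C i)
  isHermLCD lcd y y∈C′ y⊥C′ = insertAt𝟎≡0w⇒≡0w y (lcd _ y∈C′ insertAt-y⊥C)
    where
    insertAt-y⊥C : HDual C (insertAt y i 𝟎)
    insertAt-y⊥C z z∈C = begin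
      ⟨ insertAt y i 𝟎 , z ⟩H                          ≡⟨ cong (λ v → ⟨ insertAt y i 𝟎 , v ⟩H)
                                                               (insertAt-removeAt-∈C z z∈C) ⟨
      ⟨ insertAt y i 𝟎 , insertAt (removeAt z i) i 𝟎 ⟩H ≡⟨ ⟨insertAt𝟎,insertAt𝟎⟩H y (removeAt z i) i ⟩
      ⟨ y , removeAt z i ⟩H                            ≡⟨ y⊥C′ _ (removeAt-∈puncture z z∈C) ⟩
      𝟎                                                ∎
      where open ≡-Reasoning

  hasMinWt : ∀ {d} → HasMinWt C d → HasMinWt (puncture C i) d
  hasMinWt {d} ((x , x∈C , x≢0 , wt≡d) , minimal) =
    (removeAt x i , removeAt-∈puncture x x∈C , removeAt≢0w , wt-removeAt) , minimal′
    where
    removeAt≢0w : removeAt x i ≢ 0w n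
    removeAt≢0w e = x≢0 (trans (sym (insertAt-removeAt-∈C x x∈C))
                               (trans (cong (λ v → insertAt v i 𝟎) e) (insertAt𝟎-0w i)))
    wt-removeAt : wt (removeAt x i) ≡ d
    wt-removeAt = trans (sym (wt-insertAt𝟎 (removeAt x i) i))
                        (trans (cong wt (insertAt-removeAt-∈C x x∈C)) wt≡d)
    minimal′ : ∀ y → puncture C i y → y ≢ 0w n → d ≤ wt y
    minimal′ y y∈C′ y≢0 =
      subst (d ≤_) (wt-insertAt𝟎 y i) (minimal _ y∈C′ (y≢0 ∘ insertAt𝟎≡0w⇒≡0w y))

  isHermLCDCode : ∀ {k d} → IsHermLCDCode (suc n) k d C → IsHermLCDCode n k d (puncture C i)
  isHermLCDCode (subspace , lcd , minWt) =
    isSubspaceOfDim subspace , isHermLCD lcd , hasMinWt minWt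

lemma2p2 : (n k d : ℕ) → 1 ≤ n → 1 ≤ k → 1 ≤ d →
    (C : Code n) → IsHermLCDCode n k d C →
    Σ ℕ (λ m → IsD4 (n ∸ 1) k m × m ≤ d ∸ 1) →
    ∀ x → HDual C x → x ≢ 0w n → 2 ≤ wt x
lemma2p2 (suc n) k (suc d) _ _ _ C code (m , (_ , d₄-maximal) , m≤d) x x⊥C x≢0 with wt x in wt≡
... | 0           = ⊥-elim (x≢0 (wt≡0⇒≡0w x wt≡))
... | suc (suc _) = s≤s (s≤s z≤n)
... | 1 with HDual-wt≡1⇒vanishing-coordinate C x x⊥C wt≡
...   | i , vanish = ⊥-elim (n≮n d (≤-trans (d₄-maximal _ _ punctured) m≤d))
  where
  punctured : IsHermLCDCode n k (suc d) (puncture C i)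
  punctured = Puncture.isHermLCDCode C i vanish code
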